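{- Let $G$ be a connected plane graph in which all but at most $r$ vertices have degree at least three and every face is incident to at least seven edges. Then $|V(G)| \leq 10r - 28$.
   Context: A plane graph is a graph embedded in the plane without crossings. -}

module Defs where

-- Plane graphs are represented combinatorially, as (connected, simple)
-- combinatorial maps (rotation systems) of genus 0.
--   darts      : Fin n
--   σ          : rotation permutation; its orbits are the vertices
--   α          : fixed-point-free involution; its orbits are the edges
--   φ = σ ∘ α  : face permutation; its orbits are the faces
-- A connected combinatorial map is a plane map iff V - E + F = 2.

open import Data.Nat using (ℕ; zero; suc; _+_; _<ᵇ_)
open import Data.Bool using (Bool; true; false; not; _∧_; _∨_; if_then_else_)
open import Data.Fin using (Fin; toℕ; _≟_)
open import Data.Fin.Permutation using (Permutation′; _⟨$⟩ʳ_)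
open import Data.List using (List; allFin; upTo)
open import Data.Bool.ListAction using (any)
open import Relation.Nullary.Decidable using (⌊_⌋)
open import Relation.Binary.PropositionalEquality using (_≡_; _≢_)

iter : {A : Set} → (A → A) → ℕ → A → A
iter f zero    x = x
iter f (suc k) x = f (iter f k x)

count : {A : Set} → (A → Bool) → List A → ℕ
count p List.[]       = 0
count p (x List.∷ xs) = (if p x then 1 else 0) + count p xs

module _ {n : ℕ} where

  -- e lies in the orbit of d under f (an orbit of a map on Fin n is
  -- reached in fewer than n steps)
  reach : (Fin n → Fin n) → Fin n → Fin n → Bool
  reach f d e = any (λ k → ⌊ iter f k d ≟ e ⌋) (upTo n)

  orbitSize : (Fin n → Fin n) → Fin n → ℕ
  orbitSize f d = count (reach f d) (allFin n)

  isRep : (Fin n → Fin n) → Fin n → Bool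
  isRep f d = not (any (λ e → (toℕ e <ᵇ toℕ d) ∧ reach f d e) (allFin n))

record CombMap (n : ℕ) : Set where
  field
    σ : Permutation′ n
    α : Permutation′ n
    α-invol : ∀ d → α ⟨$⟩ʳ (α ⟨$⟩ʳ d) ≡ d
    α-free  : ∀ d → α ⟨$⟩ʳ d ≢ d

module _ {n : ℕ} (M : CombMap n) where
  open CombMap M

  σf αf φf : Fin n → Fin n
  σf d = σ ⟨$⟩ʳ d
  αf d = α ⟨$⟩ʳ d
  φf d = σf (αf d)

  isEdgeRep : Fin n → Bool
  isEdgeRep d = toℕ d <ᵇ toℕ (αf d)

  numVertices numEdges numFaces : ℕ
  numVertices = count (isRep σf) (allFin n)
  numEdges    = count isEdgeRep (allFin n)
  numFaces    = count (isRep φf) (allFin n)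

  -- degree of the vertex at dart d (= number of darts at it; no loops)
  degree : Fin n → ℕ
  degree d = orbitSize σf d

  faceEdges : Fin n → ℕ
  faceEdges d = count (λ e → isEdgeRep e ∧ (reach φf d e ∨ reach φf d (αf e))) (allFin n)

  numLowDegree : ℕ
  numLowDegree = count (λ d → isRep σf d ∧ (degree d <ᵇ 3)) (allFin n)

  sameVertex : Fin n → Fin n → Set
  sameVertex d e = reach σf d e ≡ true

  data Reach : Fin n → Fin n → Set where
    here  : ∀ {d} → Reach d d
    stepσ : ∀ {d e} → Reach d e → Reach d (σf e)
    stepα : ∀ {d e} → Reach d e → Reach d (αf e)

  Connected : Set
  Connected = ∀ d e → Reach d e

  Planar : Set
  Planar = numVertices + numFaces ≡ numEdges + 2

  Simple : Set
  Simple = (∀ d → ¬sv d (αf d))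
         × (∀ d e → sameVertex d e → sameVertex (αf d) (αf e) → d ≡ e)
    where
      open import Data.Product using (_×_)
      open import Relation.Nullary using (¬_)
      ¬sv : Fin n → Fin n → Set
      ¬sv a b = ¬ sameVertex a b

  IsPlaneGraph : Set
  IsPlaneGraph = Connected × Planar × Simple
    where open import Data.Product using (_×_)

{-# OPTIONS --safe #-}

-- Count the n darts three ways. Every edge has two darts, so n = 2E. A vertex has as many
-- darts as its degree: at least 1, and at least 3 except at the L vertices of low degree,
-- so 3V ≤ n + 2L. A face has at least as many darts as edges it meets, so 7F ≤ n.
-- Eliminating E and F with Euler's formula V + F = E + 2 leaves V + 28 ≤ 10L.

module Submission where

open import Defs

open import Data.Bool using (Bool; true; false; if_then_else_; _∧_; _∨_; T)
open import Data.Bool.Properties using (T-∧; T-≡; T-not-≡)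
open import Data.Fin using (Fin; toℕ) renaming (zero to fzero; suc to fsuc)
open import Data.Fin.Properties
  using (pigeonhole; toℕ-injective; toℕ<n; 0≢1+n) renaming (suc-injective to fsuc-injective)
open import Data.List using (tabulate; allFin; upTo; _∷_; [])
open import Data.List.Membership.Propositional using (lose)
open import Data.List.Membership.Propositional.Properties using (∈-upTo⁺; ∈-allFin)
open import Data.List.Relation.Unary.Any using (satisfied)
open import Data.List.Relation.Unary.Any.Properties using (any⁺; any⁻)
open import Data.Nat using (ℕ; zero; suc; _+_; _*_; _≤_; _<_; _<ᵇ_; z≤n; s≤s)
open import Data.Nat.DivMod using (_%_; _/_; m≡m%n+[m/n]*n; m%n<n)
open import Data.Nat.Properties
  using (+-*-semiring; module ≤-Reasoning; ≤-refl; ≤-reflexive; ≤-trans; ≤-antisym; ≤-pred; ≮⇒≥; <⇒<ᵇ; n<1+n;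
         m≤m+n; m≤n+m; m≤n⇒∃[o]m+o≡n; +-comm; +-suc; +-identityʳ; *-comm; *-identityˡ; *-distribʳ-+;
         +-mono-≤; +-monoˡ-≤; +-monoʳ-≤; *-monoʳ-≤; +-cancelʳ-≤)
open import Data.Nat.Tactic.RingSolver using (solve)
open import Data.Product using (∃; _×_; _,_)
open import Function using (_∘_; Injective; Injection)
open import Function.Bundles using (Equivalence)
open import Function.Construct.Composition using () renaming (injective to ∘-injective)
open import Function.Properties.Inverse using (↔⇒↣)
open import Relation.Binary.PropositionalEquality
open import Relation.Nullary using (¬_; contradiction)
open import Relation.Nullary.Decidable using (toWitness; fromWitness)

open import Algebra.Properties.Semiring.Sum +-*-semiring
  using (sum; sum-syntax; sum-cong-≗; ∑-comm; ∑-distrib-+; sum-permute; *-distribˡ-sum; *-distribʳ-sum)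

𝟙 : Bool → ℕ
𝟙 b = if b then 1 else 0

𝟙-∧ : ∀ a b → 𝟙 (a ∧ b) ≡ 𝟙 a * 𝟙 b
𝟙-∧ false b     = refl
𝟙-∧ true  false = refl
𝟙-∧ true  true  = refl

𝟙-∧-∨-≤ : ∀ a b c → 𝟙 (a ∧ (b ∨ c)) ≤ 𝟙 a * 𝟙 b + 𝟙 a * 𝟙 c
𝟙-∧-∨-≤ false b     c     = z≤n
𝟙-∧-∨-≤ true  true  c     = s≤s z≤n
𝟙-∧-∨-≤ true  false true  = ≤-refl
𝟙-∧-∨-≤ true  false false = z≤n

𝟙[m<ᵇn]+𝟙[n<ᵇm]≡1 : ∀ {m n} → m ≢ n → 𝟙 (m <ᵇ n) + 𝟙 (n <ᵇ m) ≡ 1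
𝟙[m<ᵇn]+𝟙[n<ᵇm]≡1 {zero}  {zero}  m≢n = contradiction refl m≢n
𝟙[m<ᵇn]+𝟙[n<ᵇm]≡1 {zero}  {suc n} m≢n = refl
𝟙[m<ᵇn]+𝟙[n<ᵇm]≡1 {suc m} {zero}  m≢n = refl
𝟙[m<ᵇn]+𝟙[n<ᵇm]≡1 {suc m} {suc n} m≢n = 𝟙[m<ᵇn]+𝟙[n<ᵇm]≡1 (m≢n ∘ cong suc)

∑-mono-≤ : ∀ {n} {f g : Fin n → ℕ} → (∀ i → f i ≤ g i) → sum f ≤ sum g
∑-mono-≤ {zero}  f≤g = z≤n
∑-mono-≤ {suc n} f≤g = +-mono-≤ (f≤g fzero) (∑-mono-≤ (f≤g ∘ fsuc))

∑-one : ∀ n → ∑[ i < n ] 1 ≡ n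
∑-one zero    = refl
∑-one (suc n) = cong suc (∑-one n)

f≤sum : ∀ {n} (f : Fin n → ℕ) i → f i ≤ sum f
f≤sum f fzero    = m≤m+n (f fzero) _
f≤sum f (fsuc i) = ≤-trans (f≤sum (f ∘ fsuc) i) (m≤n+m _ (f fzero))

∑-𝟙≡0 : ∀ {n} (b : Fin n → Bool) → (∀ i → ¬ T (b i)) → ∑[ i < n ] 𝟙 (b i) ≡ 0
∑-𝟙≡0 {zero}  b none = refl
∑-𝟙≡0 {suc n} b none with b fzero | none fzero
... | false | _      = ∑-𝟙≡0 (b ∘ fsuc) (none ∘ fsuc)
... | true  | ¬T[b0] = contradiction _ ¬T[b0]

∑-𝟙≤1 : ∀ {n} (b : Fin n → Bool) → (∀ {i j} → T (b i) → T (b j) → i ≡ j) →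
        ∑[ i < n ] 𝟙 (b i) ≤ 1
∑-𝟙≤1 {zero}  b unique = z≤n
∑-𝟙≤1 {suc n} b unique with b fzero in eq
... | false = ∑-𝟙≤1 (b ∘ fsuc) (λ bi bj → fsuc-injective (unique bi bj))
... | true  = s≤s (≤-reflexive (∑-𝟙≡0 (b ∘ fsuc) λ i T[bi] → 0≢1+n (unique (subst T (sym eq) _) T[bi])))

count-tabulate : ∀ {A : Set} {n} (p : A → Bool) (f : Fin n → A) →
                 count p (tabulate f) ≡ ∑[ i < n ] 𝟙 (p (f i))
count-tabulate {n = zero}  p f = refl
count-tabulate {n = suc n} p f = cong (𝟙 (p (f fzero)) +_) (count-tabulate p (f ∘ fsuc))

count-allFin : ∀ {n} (p : Fin n → Bool) → count p (allFin n) ≡ ∑[ i < n ] 𝟙 (p i)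
count-allFin p = count-tabulate p (λ i → i)

iter-+ : ∀ {A : Set} (f : A → A) j k x → iter f (j + k) x ≡ iter f j (iter f k x)
iter-+ f zero    k x = refl
iter-+ f (suc j) k x = cong f (iter-+ f j k x)

module Orbits {n : ℕ} (f : Fin n → Fin n) (f-injective : Injective _≡_ _≡_ f) where

  infix 4 _↝_
  _↝_ : Fin n → Fin n → Set
  d ↝ e = ∃ λ k → iter f k d ≡ e

  ↝-refl : ∀ {d} → d ↝ d
  ↝-refl = 0 , refl

  ↝-trans : ∀ {d e g} → d ↝ e → e ↝ g → d ↝ g
  ↝-trans {d} (j , refl) (k , refl) = k + j , iter-+ f k j d

  iter-injective : ∀ k {d e} → iter f k d ≡ iter f k e → d ≡ e
  iter-injective zero    eq = eq
  iter-injective (suc k) eq = iter-injective k (f-injective eq)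

  iter-periodic : ∀ {p d} → iter f p d ≡ d → ∀ q → iter f (q * p) d ≡ d
  iter-periodic eq zero = refl
  iter-periodic {p} {d} eq (suc q) = begin
    iter f (p + q * p) d         ≡⟨ iter-+ f p (q * p) d ⟩
    iter f p (iter f (q * p) d)  ≡⟨ cong (iter f p) (iter-periodic eq q) ⟩
    iter f p d                   ≡⟨ eq ⟩
    d                            ∎
    where open ≡-Reasoning

  period : ∀ d → ∃ λ p → suc p ≤ n × iter f (suc p) d ≡ d
  period d with i , j , i<j , fⁱd≡fʲd ← pigeonhole (n<1+n n) (λ (i : Fin (suc n)) → iter f (toℕ i) d)
           with p , i+1+p≡j ← m≤n⇒∃[o]m+o≡n i<j =
    p , 1+p≤n , sym (iter-injective (toℕ i) fⁱd≡fⁱfᵖ⁺¹d)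
    where
    1+p≤n : suc p ≤ n
    1+p≤n = begin
      suc p            ≤⟨ s≤s (m≤n+m p (toℕ i)) ⟩
      suc (toℕ i + p)  ≡⟨ i+1+p≡j ⟩
      toℕ j            ≤⟨ ≤-pred (toℕ<n j) ⟩
      n                ∎
      where open ≤-Reasoning
    fⁱd≡fⁱfᵖ⁺¹d : iter f (toℕ i) d ≡ iter f (toℕ i) (iter f (suc p) d)
    fⁱd≡fⁱfᵖ⁺¹d = begin
      iter f (toℕ i) d                   ≡⟨ fⁱd≡fʲd ⟩
      iter f (toℕ j) d                   ≡⟨ cong (λ k → iter f k d) (trans (sym i+1+p≡j) (sym (+-suc (toℕ i) p))) ⟩
      iter f (toℕ i + suc p) d           ≡⟨ iter-+ f (toℕ i) (suc p) d ⟩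
      iter f (toℕ i) (iter f (suc p) d)  ∎
      where open ≡-Reasoning

  ↝-sym : ∀ {d e} → d ↝ e → e ↝ d
  ↝-sym {d} (k , refl) with p , _ , fᵖ⁺¹d≡d ← period d = p * k , (begin
    iter f (p * k) (iter f k d)  ≡⟨ iter-+ f (p * k) k d ⟨
    iter f (p * k + k) d         ≡⟨ cong (λ m → iter f m d) (trans (+-comm (p * k) k) (*-comm (suc p) k)) ⟩
    iter f (k * suc p) d         ≡⟨ iter-periodic fᵖ⁺¹d≡d k ⟩
    d                            ∎)
    where open ≡-Reasoning

  ↝-bounded : ∀ {d e} → d ↝ e → ∃ λ k → k < n × iter f k d ≡ e
  ↝-bounded {d} (k , refl) with p , p<n , fᵖ⁺¹d≡d ← period d =
    k % suc p , ≤-trans (m%n<n k (suc p)) p<n , (begin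
      iter f (k % suc p) d                                ≡⟨ cong (iter f (k % suc p)) (iter-periodic fᵖ⁺¹d≡d (k / suc p)) ⟨
      iter f (k % suc p) (iter f (k / suc p * suc p) d)   ≡⟨ iter-+ f (k % suc p) (k / suc p * suc p) d ⟨
      iter f (k % suc p + k / suc p * suc p) d            ≡⟨ cong (λ m → iter f m d) (m≡m%n+[m/n]*n k (suc p)) ⟨
      iter f k d                                          ∎)
    where open ≡-Reasoning

  reach⇒↝ : ∀ {d e} → T (reach f d e) → d ↝ e
  reach⇒↝ r with k , fᵏd≟e ← satisfied (any⁻ _ (upTo n) r) = k , toWitness fᵏd≟e

  ↝⇒reach : ∀ {d e} → d ↝ e → T (reach f d e)
  ↝⇒reach d↝e with k , k<n , fᵏd≡e ← ↝-bounded d↝e = any⁺ _ (lose (∈-upTo⁺ k<n) (fromWitness fᵏd≡e))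

  isRep-minimal : ∀ {d e} → T (isRep f d) → d ↝ e → toℕ d ≤ toℕ e
  isRep-minimal {d} {e} rep d↝e = ≮⇒≥ λ e<d → subst T (Equivalence.to T-not-≡ rep)
    (any⁺ _ (lose (∈-allFin e) (Equivalence.from T-∧ (<⇒<ᵇ e<d , ↝⇒reach d↝e))))

  isRep-unique : ∀ {d₁ d₂ e} → T (isRep f d₁) → T (isRep f d₂) → d₁ ↝ e → d₂ ↝ e → d₁ ≡ d₂
  isRep-unique rep₁ rep₂ d₁↝e d₂↝e = toℕ-injective (≤-antisym
    (isRep-minimal rep₁ (↝-trans d₁↝e (↝-sym d₂↝e)))
    (isRep-minimal rep₂ (↝-trans d₂↝e (↝-sym d₁↝e))))

  orbitSize-pos : ∀ d → 1 ≤ orbitSize f d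
  orbitSize-pos d = begin
    1                          ≡⟨ cong 𝟙 (Equivalence.to T-≡ (↝⇒reach ↝-refl)) ⟨
    𝟙 (reach f d d)            ≤⟨ f≤sum (λ e → 𝟙 (reach f d e)) d ⟩
    ∑[ e < n ] 𝟙 (reach f d e) ≡⟨ count-allFin (reach f d) ⟨
    orbitSize f d              ∎
    where open ≤-Reasoning

  ∑-isRep-orbitSize≤n : ∑[ d < n ] (𝟙 (isRep f d) * orbitSize f d) ≤ n
  ∑-isRep-orbitSize≤n = begin
    ∑[ d < n ] (𝟙 (isRep f d) * orbitSize f d)                   ≡⟨ sum-cong-≗ (λ d → cong (𝟙 (isRep f d) *_) (count-allFin (reach f d))) ⟩
    ∑[ d < n ] (𝟙 (isRep f d) * ∑[ e < n ] 𝟙 (reach f d e))      ≡⟨ sum-cong-≗ (λ d → *-distribˡ-sum (𝟙 (isRep f d)) (λ e → 𝟙 (reach f d e))) ⟩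
    ∑[ d < n ] ∑[ e < n ] (𝟙 (isRep f d) * 𝟙 (reach f d e))      ≡⟨ ∑-comm (λ d e → 𝟙 (isRep f d) * 𝟙 (reach f d e)) ⟩
    ∑[ e < n ] ∑[ d < n ] (𝟙 (isRep f d) * 𝟙 (reach f d e))      ≡⟨ sum-cong-≗ (λ e → sum-cong-≗ (λ d → 𝟙-∧ (isRep f d) (reach f d e))) ⟨
    ∑[ e < n ] ∑[ d < n ] 𝟙 (isRep f d ∧ reach f d e)            ≤⟨ ∑-mono-≤ (λ e → ∑-𝟙≤1 _ (representative-unique e)) ⟩
    ∑[ e < n ] 1                                                 ≡⟨ ∑-one n ⟩
    n                                                            ∎
    where
    open ≤-Reasoning
    representative-unique : ∀ e {d₁ d₂} → T (isRep f d₁ ∧ reach f d₁ e) → T (isRep f d₂ ∧ reach f d₂ e) → d₁ ≡ d₂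
    representative-unique e t₁ t₂ with rep₁ , r₁ ← Equivalence.to T-∧ t₁ | rep₂ , r₂ ← Equivalence.to T-∧ t₂ =
      isRep-unique rep₁ rep₂ (reach⇒↝ r₁) (reach⇒↝ r₂)

  numOrbits : ℕ
  numOrbits = count (isRep f) (allFin n)

  numShortOrbits : ℕ → ℕ
  numShortOrbits k = count (λ d → isRep f d ∧ (orbitSize f d <ᵇ k)) (allFin n)

  *-numOrbits≡∑ : ∀ k → k * numOrbits ≡ ∑[ d < n ] (𝟙 (isRep f d) * k)
  *-numOrbits≡∑ k = begin
    k * numOrbits                   ≡⟨ *-comm k numOrbits ⟩
    numOrbits * k                   ≡⟨ cong (_* k) (count-allFin (isRep f)) ⟩
    (∑[ d < n ] 𝟙 (isRep f d)) * k  ≡⟨ *-distribʳ-sum k (𝟙 ∘ isRep f) ⟩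
    ∑[ d < n ] (𝟙 (isRep f d) * k)  ∎
    where open ≡-Reasoning

  *-numOrbits≤n : ∀ k → (∀ d → k ≤ orbitSize f d) → k * numOrbits ≤ n
  *-numOrbits≤n k k≤orbitSize = begin
    k * numOrbits                              ≡⟨ *-numOrbits≡∑ k ⟩
    ∑[ d < n ] (𝟙 (isRep f d) * k)             ≤⟨ ∑-mono-≤ (λ d → *-monoʳ-≤ (𝟙 (isRep f d)) (k≤orbitSize d)) ⟩
    ∑[ d < n ] (𝟙 (isRep f d) * orbitSize f d) ≤⟨ ∑-isRep-orbitSize≤n ⟩
    n                                          ∎
    where open ≤-Reasoning

  suc*numOrbits≤n+*numShortOrbits : ∀ k → suc k * numOrbits ≤ n + k * numShortOrbits (suc k)
  suc*numOrbits≤n+*numShortOrbits k = begin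
    suc k * numOrbits                                  ≡⟨ *-numOrbits≡∑ (suc k) ⟩
    ∑[ d < n ] (𝟙 (isRep f d) * suc k)                  ≤⟨ ∑-mono-≤ (λ d → 𝟙*suc≤ (isRep f d) (orbitSize-pos d)) ⟩
    ∑[ d < n ] (𝟙 (isRep f d) * orbitSize f d + 𝟙 (short d) * k)
                                                       ≡⟨ ∑-distrib-+ (λ d → 𝟙 (isRep f d) * orbitSize f d) (λ d → 𝟙 (short d) * k) ⟩
    ∑[ d < n ] (𝟙 (isRep f d) * orbitSize f d) + ∑[ d < n ] (𝟙 (short d) * k)
                                                       ≤⟨ +-monoˡ-≤ _ ∑-isRep-orbitSize≤n ⟩
    n + ∑[ d < n ] (𝟙 (short d) * k)                    ≡⟨ cong (n +_) (*-distribʳ-sum k (𝟙 ∘ short)) ⟨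
    n + (∑[ d < n ] 𝟙 (short d)) * k                    ≡⟨ cong (λ m → n + m * k) (count-allFin short) ⟨
    n + numShortOrbits (suc k) * k                     ≡⟨ cong (n +_) (*-comm (numShortOrbits (suc k)) k) ⟩
    n + k * numShortOrbits (suc k)                     ∎
    where
    open ≤-Reasoning
    short : Fin n → Bool
    short d = isRep f d ∧ (orbitSize f d <ᵇ suc k)
    𝟙*suc≤ : ∀ b {s} → 1 ≤ s → 𝟙 b * suc k ≤ 𝟙 b * s + 𝟙 (b ∧ (s <ᵇ suc k)) * k
    𝟙*suc≤ false 1≤s = z≤n
    𝟙*suc≤ true {s} 1≤s =
      subst₂ _≤_ (sym (*-identityˡ (suc k))) (cong (_+ 𝟙 (s <ᵇ suc k) * k) (sym (*-identityˡ s))) (suc≤ 1≤s)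
      where
      suc≤ : 1 ≤ s → suc k ≤ s + 𝟙 (s <ᵇ suc k) * k
      suc≤ 1≤s with s <ᵇ suc k in s<ᵇ1+k
      ... | true  = +-mono-≤ 1≤s (≤-reflexive (sym (+-identityʳ k)))
      ... | false = ≤-trans (≮⇒≥ λ s<1+k → subst T s<ᵇ1+k (<⇒<ᵇ s<1+k)) (m≤m+n s 0)

module _ {n : ℕ} (M : CombMap n) where
  open CombMap M

  σ-injective : Injective _≡_ _≡_ (σf M)
  σ-injective = Injection.injective (↔⇒↣ σ)

  φ-injective : Injective _≡_ _≡_ (φf M)
  φ-injective = ∘-injective _≡_ _≡_ _≡_ (Injection.injective (↔⇒↣ α)) σ-injective

  ∑-∘α : (g : Fin n → ℕ) → ∑[ d < n ] g (αf M d) ≡ sum g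
  ∑-∘α g = sym (sum-permute g α)

  isEdgeRep-exactlyOne : ∀ d → 𝟙 (isEdgeRep M d) + 𝟙 (isEdgeRep M (αf M d)) ≡ 1
  isEdgeRep-exactlyOne d rewrite α-invol d =
    𝟙[m<ᵇn]+𝟙[n<ᵇm]≡1 λ d≡αd → α-free d (toℕ-injective (sym d≡αd))

  n≡2*numEdges : n ≡ 2 * numEdges M
  n≡2*numEdges = begin
    n                                 ≡⟨ ∑-one n ⟨
    ∑[ d < n ] 1                      ≡⟨ sum-cong-≗ isEdgeRep-exactlyOne ⟨
    ∑[ d < n ] (ε d + ε (αf M d))     ≡⟨ ∑-distrib-+ ε (ε ∘ αf M) ⟩
    sum ε + ∑[ d < n ] ε (αf M d)     ≡⟨ cong (sum ε +_) (∑-∘α ε) ⟩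
    sum ε + sum ε                     ≡⟨ cong (λ m → m + m) (count-allFin (isEdgeRep M)) ⟨
    numEdges M + numEdges M           ≡⟨ cong (numEdges M +_) (+-identityʳ (numEdges M)) ⟨
    2 * numEdges M                    ∎
    where
    open ≡-Reasoning
    ε : Fin n → ℕ
    ε d = 𝟙 (isEdgeRep M d)

  -- An edge meeting the face is charged to one of its darts lying in the face; since exactly
  -- one of e, α e represents its edge, no dart is charged twice.
  faceEdges≤orbitSize : ∀ d → faceEdges M d ≤ orbitSize (φf M) d
  faceEdges≤orbitSize d = begin
    faceEdges M d                                           ≡⟨ count-allFin (λ e → isEdgeRep M e ∧ (R e ∨ R (αf M e))) ⟩
    ∑[ e < n ] 𝟙 (isEdgeRep M e ∧ (R e ∨ R (αf M e)))       ≤⟨ ∑-mono-≤ (λ e → 𝟙-∧-∨-≤ (isEdgeRep M e) (R e) (R (αf M e))) ⟩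
    ∑[ e < n ] (ε e * ρ e + ε e * ρ (αf M e))               ≡⟨ ∑-distrib-+ (λ e → ε e * ρ e) (λ e → ε e * ρ (αf M e)) ⟩
    ∑[ e < n ] (ε e * ρ e) + ∑[ e < n ] (ε e * ρ (αf M e))  ≡⟨ cong (∑[ e < n ] (ε e * ρ e) +_) reindex ⟩
    ∑[ e < n ] (ε e * ρ e) + ∑[ e < n ] (ε (αf M e) * ρ e)  ≡⟨ ∑-distrib-+ (λ e → ε e * ρ e) (λ e → ε (αf M e) * ρ e) ⟨
    ∑[ e < n ] (ε e * ρ e + ε (αf M e) * ρ e)               ≡⟨ sum-cong-≗ charged-once ⟩
    ∑[ e < n ] ρ e                                          ≡⟨ count-allFin R ⟨
    orbitSize (φf M) d                                      ∎
    where
    open ≤-Reasoning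
    R : Fin n → Bool
    R = reach (φf M) d
    ε ρ : Fin n → ℕ
    ε e = 𝟙 (isEdgeRep M e)
    ρ e = 𝟙 (R e)
    reindex : ∑[ e < n ] (ε e * ρ (αf M e)) ≡ ∑[ e < n ] (ε (αf M e) * ρ e)
    reindex = trans (sum-cong-≗ λ e → cong (λ x → ε x * ρ (αf M e)) (sym (α-invol e)))
                    (∑-∘α (λ e → ε (αf M e) * ρ e))
    charged-once : ∀ e → ε e * ρ e + ε (αf M e) * ρ e ≡ ρ e
    charged-once e = trans (sym (*-distribʳ-+ (ρ e) (ε e) (ε (αf M e))))
                           (trans (cong (_* ρ e) (isEdgeRep-exactlyOne e)) (*-identityˡ (ρ e)))

V+28≤10*L : ∀ V E F L → 3 * V ≤ 2 * E + 2 * L → 7 * F ≤ 2 * E → V + F ≡ E + 2 → V + 28 ≤ 10 * L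
V+28≤10*L V E F L vertices faces euler = +-cancelʳ-≤ (14 * V + 4 * E) (V + 28) (10 * L) (begin
  V + 28 + (14 * V + 4 * E)           ≡⟨ solve (V ∷ E ∷ []) ⟩
  5 * (3 * V) + 4 * E + 28            ≤⟨ +-monoˡ-≤ 28 (+-monoˡ-≤ (4 * E) (*-monoʳ-≤ 5 vertices)) ⟩
  5 * (2 * E + 2 * L) + 4 * E + 28    ≡⟨ solve (E ∷ L ∷ []) ⟩
  10 * L + 14 * (E + 2)               ≡⟨ cong (λ m → 10 * L + 14 * m) euler ⟨
  10 * L + 14 * (V + F)               ≡⟨ solve (L ∷ V ∷ F ∷ []) ⟩
  10 * L + 14 * V + 2 * (7 * F)       ≤⟨ +-monoʳ-≤ (10 * L + 14 * V) (*-monoʳ-≤ 2 faces) ⟩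
  10 * L + 14 * V + 2 * (2 * E)       ≡⟨ solve (L ∷ V ∷ E ∷ []) ⟩
  10 * L + (14 * V + 4 * E)           ∎)
  where open ≤-Reasoning

lemma5 : (n : ℕ) (M : CombMap n) (r : ℕ) → IsPlaneGraph M
    → numLowDegree M ≤ r
    → (∀ (d : Fin n) → 7 ≤ faceEdges M d)
    → numVertices M + 28 ≤ 10 * r
lemma5 n M r (_ , euler , _) numLowDegree≤r 7≤faceEdges =
  ≤-trans (V+28≤10*L (numVertices M) (numEdges M) (numFaces M) (numLowDegree M) vertices faces euler)
          (*-monoʳ-≤ 10 numLowDegree≤r)
  where
  vertices : 3 * numVertices M ≤ 2 * numEdges M + 2 * numLowDegree M
  vertices = subst (λ m → 3 * numVertices M ≤ m + 2 * numLowDegree M) (n≡2*numEdges M)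
    (Orbits.suc*numOrbits≤n+*numShortOrbits (σf M) (σ-injective M) 2)
  faces : 7 * numFaces M ≤ 2 * numEdges M
  faces = subst (7 * numFaces M ≤_) (n≡2*numEdges M)
    (Orbits.*-numOrbits≤n (φf M) (φ-injective M) 7 λ d → ≤-trans (7≤faceEdges d) (faceEdges≤orbitSize M d))
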